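{- Let $r\ge1$ and $n$ be integers. Define $\xi_n\in\{ -1,0,1\}$ and $\zeta_n\in\{ -2,0,2\}$ by $n\equiv\xi_n\equiv\zeta_n\pmod 3$, and let $\delta_3(n)=0$ if $3\mid n$ and $\delta_3(n)=1$ otherwise. Then $$\omega_3\Big(\frac{n}{3^r}\Big)=\frac23\,\omega_3\Big(\frac{n-\xi_n}{3^r}\Big)+\frac13\,\omega_3\Big(\frac{n-\zeta_n}{3^r}\Big)+\frac{\delta_3(n)}{3^r}.$$
   Context: For real $x$, $\|x\|$ is the distance from $x$ to the nearest integer, $\|x\|_{1/3}:=\min\{\|x\|,1/3\}$, and $\omega_3(x):=\sum_{k=0}^\infty 3^{ -k}\|3^kx\|_{1/3}$. -}

module Defs where

open import Data.Nat as ℕ using (ℕ; zero; suc)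
open import Data.Integer as ℤ using (ℤ; +_; -[1+_]; _%ℕ_)
open import Data.Rational as ℚ using (ℚ; 0ℚ; 1ℚ; _+_; _*_; _-_; _⊓_; floor; ceiling; _/_)

_^ℚ_ : ℚ → ℕ → ℚ
q ^ℚ zero = 1ℚ
q ^ℚ suc k = q * (q ^ℚ k)

ℤ→ℚ : ℤ → ℚ
ℤ→ℚ z = z / 1

three : ℚ
three = + 3 / 1

third : ℚ
third = + 1 / 3

dist : ℚ → ℚ
dist x = (x - ℤ→ℚ (floor x)) ⊓ (ℤ→ℚ (ceiling x) - x)

dist3 : ℚ → ℚ
dist3 x = dist x ⊓ third

sumTo : ℕ → (ℕ → ℚ) → ℚ
sumTo zero f = 0ℚ
sumTo (suc K) f = sumTo K f + f K

-- partial sums of ω₃(x) = Σ_{k≥0} 3^{-k} ‖3^k x‖_{1/3}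
ω₃partial : ℕ → ℚ → ℚ
ω₃partial K x = sumTo K (λ k → (third ^ℚ k) * dist3 ((three ^ℚ k) * x))

ξ : ℤ → ℤ
ξ n with n %ℕ 3
... | 0 = + 0
... | 1 = + 1
... | _ = -[1+ 0 ]

ζ : ℤ → ℤ
ζ n with n %ℕ 3
... | 0 = + 0
... | 1 = -[1+ 1 ]
... | _ = + 2

δ₃ : ℤ → ℚ
δ₃ n with n %ℕ 3
... | 0 = 0ℚ
... | _ = 1ℚ

module Submission where

-- Corollary 3.  Write ‖·‖ for ‖·‖_{1/3} and, for a scale s, put
--   defect n s = ‖n s‖ - (2/3) ‖(n-ξ) s‖ - (1/3) ‖(n-ζ) s‖.
-- The k-th summand of the combined partial sums is 3^{-k} · defect n (3^k/3^r), and
--   * defect n s = 0 for integral s (the points are integers; k ≥ r),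
--   * defect n (1/3) = δ₃(n)/3 (n-ξ and n-ζ are multiples of 3; k = r-1),
--   * defect n (3^{-j}) = 0 for j ≥ 2 (k ≤ r-2).
-- The last is the heart of the matter: ‖·‖ is affine on every cell [b/3, (b+1)/3];
-- n-ξ and n-ζ are 3a or 3(a+1), so (n-ξ)/3^j and (n-ζ)/3^j share a cell; and
-- n = (2/3)(n-ξ) + (1/3)(n-ζ), a convex mean which affine maps preserve.
-- So once K ≥ r the combination equals δ₃(n)/3^r EXACTLY, and the ε-statement follows.

module ThreePointIdentity where
  open import Defs
  open import Data.Nat as ℕ using (ℕ; zero; suc; NonZero; z≤n; s≤s)
  import Data.Nat.Properties as ℕP
  import Data.Nat.Coprimality as Coprime
  open import Data.Integer as ℤ using (ℤ; +_; -[1+_]; _%ℕ_; _/ℕ_)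
  import Data.Integer.Properties as ℤP
  import Data.Integer.DivMod as ℤD
  open import Data.Rational as ℚ
    using (ℚ; 0ℚ; 1ℚ; _+_; _*_; _-_; _⊓_; floor; ceiling; mkℚ; _≤_; _<_; *≤*; *<*)
  import Data.Rational.Properties as ℚP
  open import Data.Rational.Solver using (module +-*-Solver)
  open +-*-Solver
  open import Data.Product using (∃; _×_; _,_; proj₁; proj₂)
  open import Data.Sum using (inj₁; inj₂)
  open import Data.Empty using (⊥-elim)
  open import Relation.Binary.Definitions using (tri<; tri≈; tri>)
  open import Relation.Binary.PropositionalEquality
  open import Relation.Nullary.Decidable using (True; toWitness)
  open ≡-Reasoning

  -- The weight 2/3, written as in the statement.
  twoThirds : ℚ
  twoThirds = third + third

  ≤-by-evaluation : (p q : ℚ) → {True (p ℚP.≤? q)} → p ≤ q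
  ≤-by-evaluation p q {p≤q} = toWitness p≤q

  <-by-evaluation : (p q : ℚ) → {True (p ℚP.<? q)} → p < q
  <-by-evaluation p q {p<q} = toWitness p<q

  0≤-* : ∀ {p q} → 0ℚ ≤ p → 0ℚ ≤ q → 0ℚ ≤ p * q
  0≤-* {p} 0≤p 0≤q =
    subst (_≤ p * _) (ℚP.*-zeroʳ p) (ℚP.*-monoˡ-≤-nonNeg p {{ℚ.nonNegative 0≤p}} 0≤q)

  -- The embedding ℤ → ℚ is an ordered ring homomorphism; every ℤ→ℚ z is already
  -- the normal form z/1, which makes + and * compute.
  ℤ→ℚ-normal : ∀ z → ℤ→ℚ z ≡ mkℚ z 0 (Coprime.sym (Coprime.1-coprimeTo _))
  ℤ→ℚ-normal z = ℚP.↥p/↧p≡p (mkℚ z 0 (Coprime.sym (Coprime.1-coprimeTo _)))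

  ℤ→ℚ-+ : ∀ a b → ℤ→ℚ (a ℤ.+ b) ≡ ℤ→ℚ a + ℤ→ℚ b
  ℤ→ℚ-+ a b = sym (trans (cong₂ _+_ (ℤ→ℚ-normal a) (ℤ→ℚ-normal b))
    (ℚP./-cong (cong₂ ℤ._+_ (ℤP.*-identityʳ a) (ℤP.*-identityʳ b)) refl))

  ℤ→ℚ-* : ∀ a b → ℤ→ℚ (a ℤ.* b) ≡ ℤ→ℚ a * ℤ→ℚ b
  ℤ→ℚ-* a b = sym (cong₂ _*_ (ℤ→ℚ-normal a) (ℤ→ℚ-normal b))

  ℤ→ℚ-neg : ∀ a → ℤ→ℚ (ℤ.- a) ≡ ℚ.- ℤ→ℚ a
  ℤ→ℚ-neg a rewrite ℤ→ℚ-normal (ℤ.- a) | ℤ→ℚ-normal a with a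
  ... | + zero   = refl
  ... | + suc _  = refl
  ... | -[1+ _ ] = refl

  ℤ→ℚ-- : ∀ a b → ℤ→ℚ (a ℤ.- b) ≡ ℤ→ℚ a - ℤ→ℚ b
  ℤ→ℚ-- a b = trans (ℤ→ℚ-+ a (ℤ.- b)) (cong (λ x → ℤ→ℚ a + x) (ℤ→ℚ-neg b))

  ℤ→ℚ-+-ℕ : ∀ m n → ℤ→ℚ (+ (m ℕ.+ n)) ≡ ℤ→ℚ (+ m) + ℤ→ℚ (+ n)
  ℤ→ℚ-+-ℕ m n = trans (cong ℤ→ℚ (ℤP.pos-+ m n)) (ℤ→ℚ-+ (+ m) (+ n))

  ℤ→ℚ-suc : ∀ z → ℤ→ℚ (ℤ.suc z) ≡ 1ℚ + ℤ→ℚ z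
  ℤ→ℚ-suc = ℤ→ℚ-+ (+ 1)

  ℤ→ℚ-mono-≤ : ∀ {a b} → a ℤ.≤ b → ℤ→ℚ a ≤ ℤ→ℚ b
  ℤ→ℚ-mono-≤ {a} {b} a≤b rewrite ℤ→ℚ-normal a | ℤ→ℚ-normal b =
    *≤* (subst₂ ℤ._≤_ (sym (ℤP.*-identityʳ a)) (sym (ℤP.*-identityʳ b)) a≤b)

  ℤ→ℚ-cancel-< : ∀ {a b} → ℤ→ℚ a < ℤ→ℚ b → a ℤ.< b
  ℤ→ℚ-cancel-< {a} {b} a<b rewrite ℤ→ℚ-normal a | ℤ→ℚ-normal b with a<b
  ... | *<* a*1<b*1 = subst₂ ℤ._<_ (ℤP.*-identityʳ a) (ℤP.*-identityʳ b) a*1<b*1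

  floor-lower : ∀ p → ℤ→ℚ (floor p) ≤ p
  floor-lower p@(mkℚ m d _) rewrite ℤ→ℚ-normal (floor p) = *≤* (subst (ℤ._≤_ _)
    (trans (sym (ℤD.a≡a%n+[a/n]*n m (+ suc d))) (sym (ℤP.*-identityʳ m)))
    (ℤP.i≤j+i ((m ℤ./ + suc d) ℤ.* + suc d) (+ (m ℤD.% (+ suc d)))))

  floor-upper : ∀ p → p < ℤ→ℚ (ℤ.suc (floor p))
  floor-upper p@(mkℚ m d _) rewrite ℤ→ℚ-normal (ℤ.suc (floor p)) = *<* (subst₂ ℤ._<_
    (trans (sym (ℤD.a≡a%n+[a/n]*n m (+ suc d))) (sym (ℤP.*-identityʳ m)))
    (sym (ℤP.suc-* (floor p) (+ suc d)))
    (ℤP.+-monoˡ-< ((m ℤ./ + suc d) ℤ.* + suc d) (ℤ.+<+ (ℤD.n%d<d m (+ suc d)))))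

  <-suc⇒≤ : ∀ {a b} → a ℤ.< ℤ.suc b → a ℤ.≤ b
  <-suc⇒≤ {a} {b} a<1+b = subst₂ ℤ._≤_ (ℤP.pred-suc a) (ℤP.pred-suc b)
    (ℤP.pred-mono (ℤP.i<j⇒suc[i]≤j a<1+b))

  floor-unique : ∀ p z → ℤ→ℚ z ≤ p → p < ℤ→ℚ (ℤ.suc z) → floor p ≡ z
  floor-unique p z z≤p p<1+z = ℤP.≤-antisym
    (<-suc⇒≤ (ℤ→ℚ-cancel-< (ℚP.≤-<-trans (floor-lower p) p<1+z)))
    (<-suc⇒≤ (ℤ→ℚ-cancel-< (ℚP.≤-<-trans z≤p (floor-upper p))))

  floor-shift : ∀ z t → 0ℚ ≤ t → t < 1ℚ → floor (ℤ→ℚ z + t) ≡ z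
  floor-shift z t 0≤t t<1 = floor-unique _ z
    (subst (_≤ ℤ→ℚ z + t) (ℚP.+-identityʳ (ℤ→ℚ z)) (ℚP.+-monoʳ-≤ (ℤ→ℚ z) 0≤t))
    (subst (ℤ→ℚ z + t <_) (trans (ℚP.+-comm (ℤ→ℚ z) 1ℚ) (sym (ℤ→ℚ-suc z)))
      (ℚP.+-monoʳ-< (ℤ→ℚ z) t<1))

  ceiling-via-floor : ∀ p → ceiling p ≡ ℤ.- floor (ℚ.- p)
  ceiling-via-floor (mkℚ _ _ _) = refl

  ceiling-shift : ∀ z t → 0ℚ ≤ t → t < 1ℚ → ceiling (ℤ→ℚ z - t) ≡ z
  ceiling-shift z t 0≤t t<1 = begin
    ceiling (ℤ→ℚ z - t)                 ≡⟨ ceiling-via-floor (ℤ→ℚ z - t) ⟩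
    ℤ.- floor (ℚ.- (ℤ→ℚ z - t))         ≡⟨ cong (λ x → ℤ.- floor x) negated ⟩
    ℤ.- floor (ℤ→ℚ (ℤ.- z) + t)         ≡⟨ cong ℤ.-_ (floor-shift (ℤ.- z) t 0≤t t<1) ⟩
    ℤ.- (ℤ.- z)                         ≡⟨ ℤP.neg-involutive z ⟩
    z                                   ∎
    where
    negated : ℚ.- (ℤ→ℚ z - t) ≡ ℤ→ℚ (ℤ.- z) + t
    negated = trans (solve 2 (λ Z t → :- (Z :- t) := :- Z :+ t) refl (ℤ→ℚ z) t)
                    (cong (_+ t) (sym (ℤ→ℚ-neg z)))

  dist-int : ∀ z → dist (ℤ→ℚ z) ≡ 0ℚ
  dist-int z = begin
    (Z - ℤ→ℚ (floor Z)) ⊓ (ℤ→ℚ (ceiling Z) - Z)  ≡⟨ cong₂ (λ a b → (Z - ℤ→ℚ a) ⊓ (ℤ→ℚ b - Z)) ⌊Z⌋ ⌈Z⌉ ⟩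
    (Z - Z) ⊓ (Z - Z)                            ≡⟨ cong (λ d → d ⊓ d) (ℚP.+-inverseʳ Z) ⟩
    0ℚ                                           ∎
    where
    Z = ℤ→ℚ z
    ⌊Z⌋ : floor Z ≡ z
    ⌊Z⌋ = subst (λ x → floor x ≡ z) (ℚP.+-identityʳ Z)
      (floor-shift z 0ℚ ℚP.≤-refl (<-by-evaluation 0ℚ 1ℚ))
    ⌈Z⌉ : ceiling Z ≡ z
    ⌈Z⌉ = subst (λ x → ceiling x ≡ z) (ℚP.+-identityʳ Z)
      (ceiling-shift z 0ℚ ℚP.≤-refl (<-by-evaluation 0ℚ 1ℚ))

  −-antimonoʳ-≤ : ∀ c {a b} → a ≤ b → c - b ≤ c - a
  −-antimonoʳ-≤ c a≤b = ℚP.+-monoʳ-≤ c (ℚP.neg-antimono-≤ a≤b)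

  dist-shift : ∀ z t → 0ℚ ≤ t → t ≤ 1ℚ → dist (ℤ→ℚ z + t) ≡ t ⊓ (1ℚ - t)
  dist-shift z t 0≤t t≤1 with ℚP.<-cmp 0ℚ t | ℚP.<-cmp t 1ℚ
  ... | tri> _ _ t<0 | _ = ⊥-elim (ℚP.<-irrefl refl (ℚP.<-≤-trans t<0 0≤t))
  ... | _ | tri> _ _ 1<t = ⊥-elim (ℚP.<-irrefl refl (ℚP.<-≤-trans 1<t t≤1))
  ... | tri≈ _ refl _ | _ = trans (cong dist (ℚP.+-identityʳ (ℤ→ℚ z))) (dist-int z)
  ... | _ | tri≈ _ refl _ =
    trans (cong dist (trans (ℚP.+-comm (ℤ→ℚ z) 1ℚ) (sym (ℤ→ℚ-suc z)))) (dist-int (ℤ.suc z))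
  ... | tri< 0<t _ _ | tri< t<1 _ _ = begin
    (X - ℤ→ℚ (floor X)) ⊓ (ℤ→ℚ (ceiling X) - X) ≡⟨ cong₂ (λ a b → (X - ℤ→ℚ a) ⊓ (ℤ→ℚ b - X)) ⌊X⌋ ⌈X⌉ ⟩
    (X - ℤ→ℚ z) ⊓ (ℤ→ℚ (ℤ.suc z) - X)           ≡⟨ cong₂ _⊓_ lower upper ⟩
    t ⊓ (1ℚ - t)                                ∎
    where
    X = ℤ→ℚ z + t
    ⌊X⌋ : floor X ≡ z
    ⌊X⌋ = floor-shift z t 0≤t t<1
    X≡ : X ≡ ℤ→ℚ (ℤ.suc z) - (1ℚ - t)
    X≡ = trans (solve 2 (λ Z t → Z :+ t := (con 1ℚ :+ Z) :- (con 1ℚ :- t)) refl (ℤ→ℚ z) t)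
               (cong (_- (1ℚ - t)) (sym (ℤ→ℚ-suc z)))
    ⌈X⌉ : ceiling X ≡ ℤ.suc z
    ⌈X⌉ = trans (cong ceiling X≡) (ceiling-shift (ℤ.suc z) (1ℚ - t)
      (−-antimonoʳ-≤ 1ℚ t≤1) (ℚP.+-monoʳ-< 1ℚ (ℚP.neg-antimono-< 0<t)))
    lower : X - ℤ→ℚ z ≡ t
    lower = solve 2 (λ Z t → (Z :+ t) :- Z := t) refl (ℤ→ℚ z) t
    upper : ℤ→ℚ (ℤ.suc z) - X ≡ 1ℚ - t
    upper = trans (cong (_- X) (ℤ→ℚ-suc z))
                  (solve 2 (λ Z t → (con 1ℚ :+ Z) :- (Z :+ t) := con 1ℚ :- t) refl (ℤ→ℚ z) t)

  dist3-rising : ∀ z y → 0ℚ ≤ y → y ≤ third → dist3 (ℤ→ℚ z + y) ≡ y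
  dist3-rising z y 0≤y y≤⅓ = begin
    dist (ℤ→ℚ z + y) ⊓ third  ≡⟨ cong (_⊓ third) (dist-shift z y 0≤y y≤1) ⟩
    (y ⊓ (1ℚ - y)) ⊓ third    ≡⟨ cong (_⊓ third) (ℚP.p≤q⇒p⊓q≡p y≤1-y) ⟩
    y ⊓ third                 ≡⟨ ℚP.p≤q⇒p⊓q≡p y≤⅓ ⟩
    y                         ∎
    where
    y≤1 : y ≤ 1ℚ
    y≤1 = ℚP.≤-trans y≤⅓ (≤-by-evaluation third 1ℚ)
    y≤1-y : y ≤ 1ℚ - y
    y≤1-y = ℚP.≤-trans y≤⅓
      (ℚP.≤-trans (≤-by-evaluation third (1ℚ - third)) (−-antimonoʳ-≤ 1ℚ y≤⅓))

  dist3-flat : ∀ z y → 0ℚ ≤ y → y ≤ third → dist3 (ℤ→ℚ z + (third + y)) ≡ third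
  dist3-flat z y 0≤y y≤⅓ = begin
    dist (ℤ→ℚ z + t) ⊓ third  ≡⟨ cong (_⊓ third) (dist-shift z t 0≤t t≤1) ⟩
    (t ⊓ (1ℚ - t)) ⊓ third    ≡⟨ ℚP.p≥q⇒p⊓q≡q (ℚP.⊓-glb ⅓≤t ⅓≤1-t) ⟩
    third                     ∎
    where
    t = third + y
    ⅓≤t : third ≤ t
    ⅓≤t = subst (_≤ t) (ℚP.+-identityʳ third) (ℚP.+-monoʳ-≤ third 0≤y)
    t≤⅔ : t ≤ twoThirds
    t≤⅔ = ℚP.+-monoʳ-≤ third y≤⅓
    0≤t : 0ℚ ≤ t
    0≤t = ℚP.≤-trans (≤-by-evaluation 0ℚ third) ⅓≤t
    t≤1 : t ≤ 1ℚ
    t≤1 = ℚP.≤-trans t≤⅔ (≤-by-evaluation twoThirds 1ℚ)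
    ⅓≤1-t : third ≤ 1ℚ - t
    ⅓≤1-t = ℚP.≤-trans (≤-by-evaluation third (1ℚ - twoThirds)) (−-antimonoʳ-≤ 1ℚ t≤⅔)

  dist3-falling : ∀ z y → 0ℚ ≤ y → y ≤ third → dist3 (ℤ→ℚ z + (twoThirds + y)) ≡ third - y
  dist3-falling z y 0≤y y≤⅓ = begin
    dist (ℤ→ℚ z + t) ⊓ third  ≡⟨ cong (_⊓ third) (dist-shift z t 0≤t t≤1) ⟩
    (t ⊓ (1ℚ - t)) ⊓ third    ≡⟨ cong (_⊓ third) (ℚP.p≥q⇒p⊓q≡q 1-t≤t) ⟩
    (1ℚ - t) ⊓ third          ≡⟨ cong (_⊓ third) 1-t≡ ⟩
    (third - y) ⊓ third       ≡⟨ ℚP.p≤q⇒p⊓q≡p ⅓-y≤⅓ ⟩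
    third - y                 ∎
    where
    t = twoThirds + y
    ⅔≤t : twoThirds ≤ t
    ⅔≤t = subst (_≤ t) (ℚP.+-identityʳ twoThirds) (ℚP.+-monoʳ-≤ twoThirds 0≤y)
    0≤t : 0ℚ ≤ t
    0≤t = ℚP.≤-trans (≤-by-evaluation 0ℚ twoThirds) ⅔≤t
    t≤1 : t ≤ 1ℚ
    t≤1 = ℚP.≤-trans (ℚP.+-monoʳ-≤ twoThirds y≤⅓) (≤-by-evaluation (twoThirds + third) 1ℚ)
    1-t≤t : 1ℚ - t ≤ t
    1-t≤t = ℚP.≤-trans (−-antimonoʳ-≤ 1ℚ ⅔≤t)
      (ℚP.≤-trans (≤-by-evaluation (1ℚ - twoThirds) twoThirds) ⅔≤t)
    1-t≡ : 1ℚ - t ≡ third - y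
    1-t≡ = solve 1 (λ y → con 1ℚ :- (con twoThirds :+ y) := con third :- y) refl y
    ⅓-y≤⅓ : third - y ≤ third
    ⅓-y≤⅓ = subst (third - y ≤_) (ℚP.+-identityʳ third) (−-antimonoʳ-≤ third 0≤y)

  -- Cells.  ‖·‖_{1/3} is affine on each cell [b/3, (b+1)/3]; its intercept and
  -- slope (in the offset from b/3) depend only on b mod 3.
  cell-intercept : ℕ → ℚ
  cell-intercept 0 = 0ℚ
  cell-intercept _ = third

  cell-slope : ℕ → ℚ
  cell-slope 0 = 1ℚ
  cell-slope 1 = 0ℚ
  cell-slope _ = ℚ.- 1ℚ

  record InCell (b : ℤ) (x : ℚ) : Set where
    field
      offset      : ℚ
      0≤offset    : 0ℚ ≤ offset
      offset≤⅓    : offset ≤ third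
      decompose   : x ≡ ℤ→ℚ b * third + offset

  cell-split : ∀ b y → ℤ→ℚ b * third + y ≡ ℤ→ℚ (b /ℕ 3) + (ℤ→ℚ (+ (b %ℕ 3)) * third + y)
  cell-split b y = begin
    ℤ→ℚ b * third + y                    ≡⟨ cong (λ m → ℤ→ℚ m * third + y) (ℤD.a≡a%ℕn+[a/ℕn]*n b 3) ⟩
    ℤ→ℚ (+ e ℤ.+ q ℤ.* + 3) * third + y  ≡⟨ cong (λ v → v * third + y) homomorphic ⟩
    (E + Q * three) * third + y          ≡⟨ solve 3 (λ E Q y → (E :+ Q :* con three) :* con third :+ y
                                                      := Q :+ (E :* con third :+ y)) refl E Q y ⟩
    Q + (E * third + y)                  ∎
    where
    e = b %ℕ 3
    q = b /ℕ 3
    E = ℤ→ℚ (+ e)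
    Q = ℤ→ℚ q
    homomorphic : ℤ→ℚ (+ e ℤ.+ q ℤ.* + 3) ≡ E + Q * three
    homomorphic = trans (ℤ→ℚ-+ (+ e) (q ℤ.* + 3)) (cong (λ v → E + v) (ℤ→ℚ-* q (+ 3)))

  dist3-by-residue : ∀ e → e ℕ.< 3 → ∀ z y → 0ℚ ≤ y → y ≤ third →
    dist3 (ℤ→ℚ z + (ℤ→ℚ (+ e) * third + y)) ≡ cell-intercept e + cell-slope e * y
  dist3-by-residue 0 _ z y 0≤y y≤⅓ = begin
    dist3 (ℤ→ℚ z + (0ℚ + y))  ≡⟨ cong (λ t → dist3 (ℤ→ℚ z + t)) (ℚP.+-identityˡ y) ⟩
    dist3 (ℤ→ℚ z + y)         ≡⟨ dist3-rising z y 0≤y y≤⅓ ⟩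
    y                         ≡⟨ solve 1 (λ y → y := con 0ℚ :+ con 1ℚ :* y) refl y ⟩
    0ℚ + 1ℚ * y               ∎
  dist3-by-residue 1 _ z y 0≤y y≤⅓ =
    trans (dist3-flat z y 0≤y y≤⅓) (solve 1 (λ y → con third := con third :+ con 0ℚ :* y) refl y)
  dist3-by-residue 2 _ z y 0≤y y≤⅓ =
    trans (dist3-falling z y 0≤y y≤⅓)
          (solve 1 (λ y → con third :- y := con third :+ con (ℚ.- 1ℚ) :* y) refl y)
  dist3-by-residue (suc (suc (suc _))) (s≤s (s≤s (s≤s ())))

  dist3-on-cell : ∀ {b x} (c : InCell b x) →
    dist3 x ≡ cell-intercept (b %ℕ 3) + cell-slope (b %ℕ 3) * InCell.offset c
  dist3-on-cell {b} c = trans (cong dist3 (trans decompose (cell-split b offset)))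
    (dist3-by-residue (b %ℕ 3) (ℤD.n%ℕd<d b 3) (b /ℕ 3) offset 0≤offset offset≤⅓)
    where open InCell c

  record ConvexWeights (w w′ : ℚ) : Set where
    field
      0≤w   : 0ℚ ≤ w
      0≤w′  : 0ℚ ≤ w′
      sum≡1 : w + w′ ≡ 1ℚ

  affine-mean : ∀ α β {w w′} → ConvexWeights w w′ → ∀ y y′ →
    α + β * (w * y + w′ * y′) ≡ w * (α + β * y) + w′ * (α + β * y′)
  affine-mean α β {w} {w′} weights y y′ = begin
    α + β * m                    ≡⟨ solve 2 (λ α v → α :+ v := con 1ℚ :* α :+ v) refl α (β * m) ⟩
    1ℚ * α + β * m               ≡⟨ cong (λ s → s * α + β * m) (sym sum≡1) ⟩
    (w + w′) * α + β * m         ≡⟨ solve 6 (λ α β w w′ y y′ → (w :+ w′) :* α :+ β :* (w :* y :+ w′ :* y′)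
                                          := w :* (α :+ β :* y) :+ w′ :* (α :+ β :* y′)) refl α β w w′ y y′ ⟩
    w * (α + β * y) + w′ * (α + β * y′) ∎
    where
    open ConvexWeights weights
    m = w * y + w′ * y′

  mean-bounds : ∀ {w w′} → ConvexWeights w w′ → ∀ {h y y′} →
    0ℚ ≤ y → y ≤ h → 0ℚ ≤ y′ → y′ ≤ h → 0ℚ ≤ w * y + w′ * y′ × w * y + w′ * y′ ≤ h
  mean-bounds {w} {w′} weights {h} 0≤y y≤h 0≤y′ y′≤h =
    ℚP.+-mono-≤ (0≤-* 0≤w 0≤y) (0≤-* 0≤w′ 0≤y′) ,
    subst (w * _ + w′ * _ ≤_) weighted-h
      (ℚP.+-mono-≤ (ℚP.*-monoˡ-≤-nonNeg w {{ℚ.nonNegative 0≤w}} y≤h)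
                   (ℚP.*-monoˡ-≤-nonNeg w′ {{ℚ.nonNegative 0≤w′}} y′≤h))
    where
    open ConvexWeights weights
    weighted-h : w * h + w′ * h ≡ h
    weighted-h = trans (sym (ℚP.*-distribʳ-+ h w w′))
                       (trans (cong (_* h) sum≡1) (ℚP.*-identityˡ h))

  mean-in-cell : ∀ {w w′} → ConvexWeights w w′ → ∀ {b x x′} →
    InCell b x → InCell b x′ → InCell b (w * x + w′ * x′)
  mean-in-cell {w} {w′} weights {b} {x} {x′} c c′ = record
    { offset    = w * y + w′ * y′
    ; 0≤offset  = proj₁ bounds
    ; offset≤⅓  = proj₂ bounds
    ; decompose = begin
        w * x + w′ * x′                 ≡⟨ cong₂ (λ u v → w * u + w′ * v) (InCell.decompose c) (InCell.decompose c′) ⟩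
        w * (B + y) + w′ * (B + y′)     ≡⟨ solve 5 (λ w w′ B y y′ → w :* (B :+ y) :+ w′ :* (B :+ y′)
                                                   := (w :+ w′) :* B :+ (w :* y :+ w′ :* y′)) refl w w′ B y y′ ⟩
        (w + w′) * B + (w * y + w′ * y′) ≡⟨ cong (λ s → s * B + (w * y + w′ * y′)) (ConvexWeights.sum≡1 weights) ⟩
        1ℚ * B + (w * y + w′ * y′)      ≡⟨ cong (_+ (w * y + w′ * y′)) (ℚP.*-identityˡ B) ⟩
        B + (w * y + w′ * y′)           ∎
    }
    where
    B = ℤ→ℚ b * third
    y = InCell.offset c
    y′ = InCell.offset c′
    bounds = mean-bounds weights (InCell.0≤offset c) (InCell.offset≤⅓ c)
                                 (InCell.0≤offset c′) (InCell.offset≤⅓ c′)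

  dist3-mean-in-cell : ∀ {w w′} → ConvexWeights w w′ → ∀ {b x x′} →
    InCell b x → InCell b x′ → dist3 (w * x + w′ * x′) ≡ w * dist3 x + w′ * dist3 x′
  dist3-mean-in-cell {w} {w′} weights {b} {x} {x′} c c′ = begin
    dist3 (w * x + w′ * x′)              ≡⟨ dist3-on-cell (mean-in-cell weights c c′) ⟩
    α + β * (w * y + w′ * y′)            ≡⟨ affine-mean α β weights y y′ ⟩
    w * (α + β * y) + w′ * (α + β * y′)  ≡⟨ sym (cong₂ (λ u v → w * u + w′ * v) (dist3-on-cell c) (dist3-on-cell c′)) ⟩
    w * dist3 x + w′ * dist3 x′          ∎
    where
    α = cell-intercept (b %ℕ 3)
    β = cell-slope (b %ℕ 3)
    y = InCell.offset c
    y′ = InCell.offset c′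

  ^ℚ-+ : ∀ q k j → q ^ℚ (k ℕ.+ j) ≡ q ^ℚ k * q ^ℚ j
  ^ℚ-+ q zero    j = sym (ℚP.*-identityˡ (q ^ℚ j))
  ^ℚ-+ q (suc k) j = trans (cong (q *_) (^ℚ-+ q k j)) (sym (ℚP.*-assoc q (q ^ℚ k) (q ^ℚ j)))

  three^-integral : ∀ i → three ^ℚ i ≡ ℤ→ℚ (+ (3 ℕ.^ i))
  three^-integral zero    = refl
  three^-integral (suc i) = trans (cong (three *_) (three^-integral i))
    (sym (trans (cong ℤ→ℚ (ℤP.pos-* 3 (3 ℕ.^ i))) (ℤ→ℚ-* (+ 3) (+ (3 ℕ.^ i)))))

  three^*third^ : ∀ k → three ^ℚ k * third ^ℚ k ≡ 1ℚ
  three^*third^ zero    = refl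
  three^*third^ (suc k) = trans
    (solve 2 (λ a b → (con three :* a) :* (con third :* b) := a :* b) refl (three ^ℚ k) (third ^ℚ k))
    (three^*third^ k)

  3^i*third^i : ∀ i → ℤ→ℚ (+ (3 ℕ.^ i)) * third ^ℚ i ≡ 1ℚ
  3^i*third^i i = trans (cong (_* third ^ℚ i) (sym (three^-integral i))) (three^*third^ i)

  0≤third^ : ∀ k → 0ℚ ≤ third ^ℚ k
  0≤third^ zero    = ≤-by-evaluation 0ℚ 1ℚ
  0≤third^ (suc k) = 0≤-* (≤-by-evaluation 0ℚ third) (0≤third^ k)

  -- With c = a mod 3^i, the points (a + e)/3^{i+1}, e ∈ {0, 1}, are
  -- ⌊a/3^i⌋/3 + (c + e)/3^{i+1} with c + e ≤ 3^i: two neighbouring grid points of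
  -- mesh 3^{-(i+1)} always share a cell.

  neighbours-share-cell : ∀ i a → ∃ λ b → ∀ e → e ℕ.≤ 1 → InCell b (ℤ→ℚ (a ℤ.+ + e) * third ^ℚ suc i)
  neighbours-share-cell i a = q , in-cell
    where
    instance
      3^i≢0 : NonZero (3 ℕ.^ i)
      3^i≢0 = ℕP.m^n≢0 3 i
    c = a %ℕ (3 ℕ.^ i)
    q = a /ℕ (3 ℕ.^ i)
    t = third ^ℚ i
    T = third ^ℚ suc i
    C = ℤ→ℚ (+ c)
    Q = ℤ→ℚ q
    P = ℤ→ℚ (+ (3 ℕ.^ i))
    full-offset : P * T ≡ third
    full-offset = begin
      P * (third * t)  ≡⟨ solve 3 (λ P ⅓ t → P :* (⅓ :* t) := ⅓ :* (P :* t)) refl P third t ⟩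
      third * (P * t)  ≡⟨ cong (third *_) (3^i*third^i i) ⟩
      third * 1ℚ       ≡⟨ ℚP.*-identityʳ third ⟩
      third            ∎
    in-cell : ∀ e → e ℕ.≤ 1 → InCell q (ℤ→ℚ (a ℤ.+ + e) * T)
    in-cell e e≤1 = record
      { offset    = ℤ→ℚ (+ (c ℕ.+ e)) * T
      ; 0≤offset  = 0≤-* (ℤ→ℚ-mono-≤ {+ 0} {+ (c ℕ.+ e)} (ℤ.+≤+ z≤n)) (0≤third^ (suc i))
      ; offset≤⅓  = subst (ℤ→ℚ (+ (c ℕ.+ e)) * T ≤_) full-offset
          (ℚP.*-monoʳ-≤-nonNeg T {{ℚ.nonNegative (0≤third^ (suc i))}} (ℤ→ℚ-mono-≤ {+ (c ℕ.+ e)} (ℤ.+≤+ c+e≤3^i)))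
      ; decompose = decomposition
      }
      where
      E = ℤ→ℚ (+ e)
      c+e≤3^i : c ℕ.+ e ℕ.≤ 3 ℕ.^ i
      c+e≤3^i = ℕP.≤-trans (ℕP.+-monoʳ-≤ c e≤1)
        (subst (ℕ._≤ 3 ℕ.^ i) (ℕP.+-comm 1 c) (ℤD.n%ℕd<d a (3 ℕ.^ i)))
      decomposition : ℤ→ℚ (a ℤ.+ + e) * T ≡ Q * third + ℤ→ℚ (+ (c ℕ.+ e)) * T
      decomposition = begin
        ℤ→ℚ (a ℤ.+ + e) * T
          ≡⟨ cong (λ m → ℤ→ℚ (m ℤ.+ + e) * T) (ℤD.a≡a%ℕn+[a/ℕn]*n a (3 ℕ.^ i)) ⟩
        ℤ→ℚ (+ c ℤ.+ q ℤ.* + (3 ℕ.^ i) ℤ.+ + e) * T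
          ≡⟨ cong (_* T) (begin
              ℤ→ℚ (+ c ℤ.+ q ℤ.* + (3 ℕ.^ i) ℤ.+ + e)   ≡⟨ ℤ→ℚ-+ (+ c ℤ.+ q ℤ.* + (3 ℕ.^ i)) (+ e) ⟩
              ℤ→ℚ (+ c ℤ.+ q ℤ.* + (3 ℕ.^ i)) + E       ≡⟨ cong (_+ E) (ℤ→ℚ-+ (+ c) (q ℤ.* + (3 ℕ.^ i))) ⟩
              C + ℤ→ℚ (q ℤ.* + (3 ℕ.^ i)) + E           ≡⟨ cong (λ v → C + v + E) (ℤ→ℚ-* q (+ (3 ℕ.^ i))) ⟩
              C + Q * P + E                             ∎) ⟩
        (C + Q * P + E) * (third * t)
          ≡⟨ solve 6 (λ C Q P E ⅓ t → (C :+ Q :* P :+ E) :* (⅓ :* t)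
                                     := Q :* ⅓ :* (P :* t) :+ (C :+ E) :* (⅓ :* t)) refl C Q P E third t ⟩
        Q * third * (P * t) + (C + E) * T
          ≡⟨ cong (λ u → Q * third * u + (C + E) * T) (3^i*third^i i) ⟩
        Q * third * 1ℚ + (C + E) * T
          ≡⟨ cong₂ _+_ (ℚP.*-identityʳ (Q * third)) (cong (_* T) (sym (ℤ→ℚ-+-ℕ c e))) ⟩
        Q * third + ℤ→ℚ (+ (c ℕ.+ e)) * T ∎

  record NearMultiple (a m : ℤ) : Set where
    constructor near
    field
      step   : ℕ
      step≤1 : step ℕ.≤ 1
      m≡     : m ≡ + 3 ℤ.* (a ℤ.+ + step)

  subtract-correction : ∀ {n} a x e e′ → n ≡ + e ℤ.+ a ℤ.* + 3 → + e ℤ.- x ≡ + 3 ℤ.* + e′ →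
    n ℤ.- x ≡ + 3 ℤ.* (a ℤ.+ + e′)
  subtract-correction {n} a x e e′ n≡ e-x≡ = begin
    n ℤ.- x                      ≡⟨ cong (ℤ._- x) n≡ ⟩
    (+ e ℤ.+ a ℤ.* + 3) ℤ.- x    ≡⟨ cong (ℤ._- x) (ℤP.+-comm (+ e) (a ℤ.* + 3)) ⟩
    (a ℤ.* + 3 ℤ.+ + e) ℤ.- x    ≡⟨ ℤP.+-assoc (a ℤ.* + 3) (+ e) (ℤ.- x) ⟩
    a ℤ.* + 3 ℤ.+ (+ e ℤ.- x)    ≡⟨ cong₂ ℤ._+_ (ℤP.*-comm a (+ 3)) e-x≡ ⟩
    + 3 ℤ.* a ℤ.+ + 3 ℤ.* + e′   ≡⟨ sym (ℤP.*-distribˡ-+ (+ 3) a (+ e′)) ⟩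
    + 3 ℤ.* (a ℤ.+ + e′)         ∎

  n-ξ-near : ∀ n → NearMultiple (n /ℕ 3) (n ℤ.- ξ n)
  n-ξ-near n with n %ℕ 3 | ℤD.a≡a%ℕn+[a/ℕn]*n n 3 | ℤD.n%ℕd<d n 3
  ... | 0 | n≡ | _ = near 0 z≤n (subtract-correction (n /ℕ 3) (+ 0) 0 0 n≡ refl)
  ... | 1 | n≡ | _ = near 0 z≤n (subtract-correction (n /ℕ 3) (+ 1) 1 0 n≡ refl)
  ... | 2 | n≡ | _ = near 1 (s≤s z≤n) (subtract-correction (n /ℕ 3) -[1+ 0 ] 2 1 n≡ refl)
  ... | suc (suc (suc _)) | _ | s≤s (s≤s (s≤s ()))

  n-ζ-near : ∀ n → NearMultiple (n /ℕ 3) (n ℤ.- ζ n)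
  n-ζ-near n with n %ℕ 3 | ℤD.a≡a%ℕn+[a/ℕn]*n n 3 | ℤD.n%ℕd<d n 3
  ... | 0 | n≡ | _ = near 0 z≤n (subtract-correction (n /ℕ 3) (+ 0) 0 0 n≡ refl)
  ... | 1 | n≡ | _ = near 1 (s≤s z≤n) (subtract-correction (n /ℕ 3) -[1+ 1 ] 1 1 n≡ refl)
  ... | 2 | n≡ | _ = near 0 z≤n (subtract-correction (n /ℕ 3) (+ 2) 2 0 n≡ refl)
  ... | suc (suc (suc _)) | _ | s≤s (s≤s (s≤s ()))

  ξζ-balance : ∀ n → + 2 ℤ.* ξ n ℤ.+ ζ n ≡ + 0
  ξζ-balance n with n %ℕ 3
  ... | 0           = refl
  ... | 1           = refl
  ... | suc (suc _) = refl

  barycentre : ∀ n s → ℤ→ℚ n * s ≡ twoThirds * (ℤ→ℚ (n ℤ.- ξ n) * s) + third * (ℤ→ℚ (n ℤ.- ζ n) * s)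
  barycentre n s = sym (begin
    twoThirds * (ℤ→ℚ (n ℤ.- ξ n) * s) + third * (ℤ→ℚ (n ℤ.- ζ n) * s)
      ≡⟨ cong₂ (λ u v → twoThirds * (u * s) + third * (v * s)) (ℤ→ℚ-- n (ξ n)) (ℤ→ℚ-- n (ζ n)) ⟩
    twoThirds * ((N - X) * s) + third * ((N - Z) * s)
      ≡⟨ solve 4 (λ N X Z s → con twoThirds :* ((N :- X) :* s) :+ con third :* ((N :- Z) :* s)
                             := N :* s :- con third :* ((con (ℤ→ℚ (+ 2)) :* X :+ Z) :* s)) refl N X Z s ⟩
    N * s - third * ((ℤ→ℚ (+ 2) * X + Z) * s)
      ≡⟨ cong (λ v → N * s - third * (v * s)) balanced ⟩
    N * s - third * (0ℚ * s)
      ≡⟨ solve 2 (λ N s → N :* s :- con third :* (con 0ℚ :* s) := N :* s) refl N s ⟩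
    N * s ∎)
    where
    N = ℤ→ℚ n
    X = ℤ→ℚ (ξ n)
    Z = ℤ→ℚ (ζ n)
    balanced : ℤ→ℚ (+ 2) * X + Z ≡ 0ℚ
    balanced = trans (sym (trans (ℤ→ℚ-+ (+ 2 ℤ.* ξ n) (ζ n)) (cong (_+ Z) (ℤ→ℚ-* (+ 2) (ξ n)))))
                     (cong ℤ→ℚ (ξζ-balance n))

  thirds-of-multiple : ∀ k s → ℤ→ℚ (+ 3 ℤ.* k) * (third * s) ≡ ℤ→ℚ k * s
  thirds-of-multiple k s = trans (cong (_* (third * s)) (ℤ→ℚ-* (+ 3) k))
    (solve 2 (λ K s → (con three :* K) :* (con third :* s) := K :* s) refl (ℤ→ℚ k) s)

  dist3-int : ∀ z → dist3 (ℤ→ℚ z) ≡ 0ℚ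
  dist3-int z = cong (_⊓ third) (dist-int z)

  defect : ℤ → ℚ → ℚ
  defect n s = dist3 (ℤ→ℚ n * s) - twoThirds * dist3 (ℤ→ℚ (n ℤ.- ξ n) * s)
                                 - third * dist3 (ℤ→ℚ (n ℤ.- ζ n) * s)

  defect-cong : ∀ {x x′ y y′ z z′} → x ≡ x′ → y ≡ y′ → z ≡ z′ →
    x - twoThirds * y - third * z ≡ x′ - twoThirds * y′ - third * z′
  defect-cong refl refl refl = refl

  dist3-integral-point : ∀ k m → dist3 (ℤ→ℚ k * ℤ→ℚ m) ≡ 0ℚ
  dist3-integral-point k m = trans (cong dist3 (sym (ℤ→ℚ-* k m))) (dist3-int (k ℤ.* m))

  -- At an integral scale all three points are integers.
  defect-integral : ∀ n m → defect n (ℤ→ℚ m) ≡ 0ℚ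
  defect-integral n m = defect-cong (dist3-integral-point n m)
    (dist3-integral-point (n ℤ.- ξ n) m) (dist3-integral-point (n ℤ.- ζ n) m)

  dist3-third-of-multiple : ∀ {a m} → NearMultiple a m → dist3 (ℤ→ℚ m * third) ≡ 0ℚ
  dist3-third-of-multiple {a} (near e _ refl) = trans
    (cong dist3 (trans (cong (ℤ→ℚ (+ 3 ℤ.* (a ℤ.+ + e)) *_) (sym (ℚP.*-identityʳ third)))
                       (trans (thirds-of-multiple (a ℤ.+ + e) 1ℚ) (ℚP.*-identityʳ (ℤ→ℚ (a ℤ.+ + e))))))
    (dist3-int (a ℤ.+ + e))

  -- n/3 sits at the start of the cell of n, so ‖n/3‖ is the intercept there: δ₃(n)/3.
  dist3-n/3 : ∀ n → dist3 (ℤ→ℚ n * third) ≡ δ₃ n * third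
  dist3-n/3 n = trans (dist3-on-cell n/3-in-cell) value-at-start
    where
    n/3-in-cell : InCell n (ℤ→ℚ n * third)
    n/3-in-cell = record
      { offset = 0ℚ ; 0≤offset = ℚP.≤-refl ; offset≤⅓ = ≤-by-evaluation 0ℚ third
      ; decompose = sym (ℚP.+-identityʳ (ℤ→ℚ n * third)) }
    value-at-start : cell-intercept (n %ℕ 3) + cell-slope (n %ℕ 3) * 0ℚ ≡ δ₃ n * third
    value-at-start with n %ℕ 3
    ... | 0           = refl
    ... | 1           = refl
    ... | suc (suc _) = refl

  -- At scale 1/3 the points n - ξ and n - ζ become integers.
  defect-third : ∀ n → defect n third ≡ δ₃ n * third
  defect-third n = trans
    (defect-cong (dist3-n/3 n) (dist3-third-of-multiple (n-ξ-near n)) (dist3-third-of-multiple (n-ζ-near n)))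
    (solve 1 (λ d → d :- con twoThirds :* con 0ℚ :- con third :* con 0ℚ := d) refl (δ₃ n * third))

  -- At scale 3^{-(i+2)} the points (n-ξ)s and (n-ζ)s are neighbouring grid points of
  -- mesh 3^{-(i+1)}, so they share a cell, on which ‖·‖_{1/3} is affine; and n s is
  -- their (2/3, 1/3)-mean.
  defect-fine : ∀ n i → defect n (third ^ℚ (2 ℕ.+ i)) ≡ 0ℚ
  defect-fine n i = begin
    dist3 (ℤ→ℚ n * s) - twoThirds * d₁ - third * d₂              ≡⟨ cong (λ v → v - twoThirds * d₁ - third * d₂) mean ⟩
    (twoThirds * d₁ + third * d₂) - twoThirds * d₁ - third * d₂  ≡⟨ solve 2 (λ d₁ d₂ → (con twoThirds :* d₁ :+ con third :* d₂)
                                                                     :- con twoThirds :* d₁ :- con third :* d₂ := con 0ℚ) refl d₁ d₂ ⟩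
    0ℚ                                                           ∎
    where
    s = third ^ℚ (2 ℕ.+ i)
    d₁ = dist3 (ℤ→ℚ (n ℤ.- ξ n) * s)
    d₂ = dist3 (ℤ→ℚ (n ℤ.- ζ n) * s)
    a = n /ℕ 3
    b = proj₁ (neighbours-share-cell i a)
    in-cell : ∀ {m} → NearMultiple a m → InCell b (ℤ→ℚ m * s)
    in-cell (near e e≤1 refl) = subst (InCell b) (sym (thirds-of-multiple (a ℤ.+ + e) (third ^ℚ suc i)))
      (proj₂ (neighbours-share-cell i a) e e≤1)
    weights : ConvexWeights twoThirds third
    weights = record
      { 0≤w = ≤-by-evaluation 0ℚ twoThirds ; 0≤w′ = ≤-by-evaluation 0ℚ third ; sum≡1 = refl }
    mean : dist3 (ℤ→ℚ n * s) ≡ twoThirds * d₁ + third * d₂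
    mean = trans (cong dist3 (barycentre n s))
                 (dist3-mean-in-cell weights (in-cell (n-ξ-near n)) (in-cell (n-ζ-near n)))

  sumTo-combination : ∀ K u v f g h →
    sumTo K f - u * sumTo K g - v * sumTo K h ≡ sumTo K (λ k → f k - u * g k - v * h k)
  sumTo-combination zero    u v f g h =
    solve 2 (λ u v → con 0ℚ :- u :* con 0ℚ :- v :* con 0ℚ := con 0ℚ) refl u v
  sumTo-combination (suc K) u v f g h = trans
    (solve 8 (λ u v a b c x y z → (a :+ x) :- u :* (b :+ y) :- v :* (c :+ z)
                                := (a :- u :* b :- v :* c) :+ (x :- u :* y :- v :* z))
      refl u v (sumTo K f) (sumTo K g) (sumTo K h) (f K) (g K) (h K))
    (cong (_+ (f K - u * g K - v * h K)) (sumTo-combination K u v f g h))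

  sumTo-vanishing : ∀ K f → (∀ k → k ℕ.< K → f k ≡ 0ℚ) → sumTo K f ≡ 0ℚ
  sumTo-vanishing zero    f _      = refl
  sumTo-vanishing (suc K) f vanish = cong₂ _+_
    (sumTo-vanishing K f (λ k k<K → vanish k (ℕP.m<n⇒m<1+n k<K))) (vanish K (ℕP.n<1+n K))

  sumTo-single : ∀ K f p → p ℕ.< K → (∀ k → k ≢ p → f k ≡ 0ℚ) → sumTo K f ≡ f p
  sumTo-single (suc K) f p p<1+K off with ℕP.m≤n⇒m<n∨m≡n (ℕP.≤-pred p<1+K)
  ... | inj₁ p<K = begin
    sumTo K f + f K  ≡⟨ cong₂ _+_ (sumTo-single K f p p<K off) (off K (≢-sym (ℕP.<⇒≢ p<K))) ⟩
    f p + 0ℚ         ≡⟨ ℚP.+-identityʳ (f p) ⟩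
    f p              ∎
  ... | inj₂ refl = begin
    sumTo p f + f p  ≡⟨ cong (_+ f p) (sumTo-vanishing p f (λ k k<p → off k (ℕP.<⇒≢ k<p))) ⟩
    0ℚ + f p         ≡⟨ ℚP.+-identityˡ (f p) ⟩
    f p              ∎

  ω₃term : ℚ → ℕ → ℚ
  ω₃term x k = third ^ℚ k * dist3 (three ^ℚ k * x)

  summand-defect : ∀ n s k →
    ω₃term (ℤ→ℚ n * s) k - twoThirds * ω₃term (ℤ→ℚ (n ℤ.- ξ n) * s) k
                         - third * ω₃term (ℤ→ℚ (n ℤ.- ζ n) * s) k
      ≡ third ^ℚ k * defect n (three ^ℚ k * s)
  summand-defect n s k = begin
    T * dist3 (A * (N * s)) - twoThirds * (T * dist3 (A * (X * s))) - third * (T * dist3 (A * (Z * s)))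
      ≡⟨ cong₂ (λ u v → T * u - twoThirds * (T * v) - third * (T * dist3 (A * (Z * s))))
               (cong dist3 (rescale N)) (cong dist3 (rescale X)) ⟩
    T * dist3 (N * (A * s)) - twoThirds * (T * dist3 (X * (A * s))) - third * (T * dist3 (A * (Z * s)))
      ≡⟨ cong (λ w → T * dist3 (N * (A * s)) - twoThirds * (T * dist3 (X * (A * s))) - third * (T * w))
              (cong dist3 (rescale Z)) ⟩
    T * d₀ - twoThirds * (T * d₁) - third * (T * d₂)
      ≡⟨ solve 4 (λ T d₀ d₁ d₂ → T :* d₀ :- con twoThirds :* (T :* d₁) :- con third :* (T :* d₂)
                                 := T :* (d₀ :- con twoThirds :* d₁ :- con third :* d₂)) refl T d₀ d₁ d₂ ⟩
    T * defect n (A * s) ∎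
    where
    T = third ^ℚ k
    A = three ^ℚ k
    N = ℤ→ℚ n
    X = ℤ→ℚ (n ℤ.- ξ n)
    Z = ℤ→ℚ (n ℤ.- ζ n)
    d₀ = dist3 (N * (A * s))
    d₁ = dist3 (X * (A * s))
    d₂ = dist3 (Z * (A * s))
    rescale : ∀ M → A * (M * s) ≡ M * (A * s)
    rescale M = solve 3 (λ A M s → A :* (M :* s) := M :* (A :* s)) refl A M s

  scale-below : ∀ k j → three ^ℚ k * third ^ℚ (k ℕ.+ j) ≡ third ^ℚ j
  scale-below k j = begin
    three ^ℚ k * third ^ℚ (k ℕ.+ j)          ≡⟨ cong (three ^ℚ k *_) (^ℚ-+ third k j) ⟩
    three ^ℚ k * (third ^ℚ k * third ^ℚ j)   ≡⟨ sym (ℚP.*-assoc (three ^ℚ k) (third ^ℚ k) (third ^ℚ j)) ⟩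
    three ^ℚ k * third ^ℚ k * third ^ℚ j     ≡⟨ cong (_* third ^ℚ j) (three^*third^ k) ⟩
    1ℚ * third ^ℚ j                          ≡⟨ ℚP.*-identityˡ (third ^ℚ j) ⟩
    third ^ℚ j                               ∎

  scale-above : ∀ r i → three ^ℚ (r ℕ.+ i) * third ^ℚ r ≡ ℤ→ℚ (+ (3 ℕ.^ i))
  scale-above r i = begin
    three ^ℚ (r ℕ.+ i) * third ^ℚ r           ≡⟨ cong (_* third ^ℚ r) (^ℚ-+ three r i) ⟩
    three ^ℚ r * three ^ℚ i * third ^ℚ r      ≡⟨ solve 3 (λ a b c → a :* b :* c := b :* (a :* c)) refl
                                                   (three ^ℚ r) (three ^ℚ i) (third ^ℚ r) ⟩
    three ^ℚ i * (three ^ℚ r * third ^ℚ r)    ≡⟨ cong (three ^ℚ i *_) (three^*third^ r) ⟩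
    three ^ℚ i * 1ℚ                           ≡⟨ ℚP.*-identityʳ (three ^ℚ i) ⟩
    three ^ℚ i                                ≡⟨ three^-integral i ⟩
    ℤ→ℚ (+ (3 ℕ.^ i))                         ∎

  defect-off-top : ∀ n r′ k → k ≢ r′ → defect n (three ^ℚ k * third ^ℚ suc r′) ≡ 0ℚ
  defect-off-top n r′ k k≢r′ with ℕP.<-cmp k r′
  ... | tri≈ _ k≡r′ _ = ⊥-elim (k≢r′ k≡r′)
  ... | tri< k<r′ _ _ with ℕP.m≤n⇒∃[o]m+o≡n k<r′
  ...   | j , refl = begin
    defect n (three ^ℚ k * third ^ℚ (2 ℕ.+ (k ℕ.+ j)))  ≡⟨ cong (λ e → defect n (three ^ℚ k * third ^ℚ e)) exponent ⟩
    defect n (three ^ℚ k * third ^ℚ (k ℕ.+ (2 ℕ.+ j)))  ≡⟨ cong (defect n) (scale-below k (2 ℕ.+ j)) ⟩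
    defect n (third ^ℚ (2 ℕ.+ j))                       ≡⟨ defect-fine n j ⟩
    0ℚ                                                  ∎
    where
    exponent : 2 ℕ.+ (k ℕ.+ j) ≡ k ℕ.+ (2 ℕ.+ j)
    exponent = sym (trans (ℕP.+-suc k (suc j)) (cong suc (ℕP.+-suc k j)))
  defect-off-top n r′ k k≢r′ | tri> _ _ r′<k with ℕP.m≤n⇒∃[o]m+o≡n r′<k
  ...   | i , refl = trans (cong (defect n) (scale-above (suc r′) i)) (defect-integral n (+ (3 ℕ.^ i)))

  defect-top : ∀ n r′ → defect n (three ^ℚ r′ * third ^ℚ suc r′) ≡ δ₃ n * third
  defect-top n r′ = begin
    defect n (three ^ℚ r′ * third ^ℚ suc r′)       ≡⟨ cong (λ e → defect n (three ^ℚ r′ * third ^ℚ e)) (ℕP.+-comm 1 r′) ⟩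
    defect n (three ^ℚ r′ * third ^ℚ (r′ ℕ.+ 1))   ≡⟨ cong (defect n) (trans (scale-below r′ 1) (ℚP.*-identityʳ third)) ⟩
    defect n third                                 ≡⟨ defect-third n ⟩
    δ₃ n * third                                   ∎

  -- Once K ≥ r = r′ + 1, only the r′-th summand survives: the combination of
  -- partial sums is exactly δ₃(n)/3^r.
  combination-exact : ∀ r′ n K → suc r′ ℕ.≤ K →
    ω₃partial K (ℤ→ℚ n * third ^ℚ suc r′) - twoThirds * ω₃partial K (ℤ→ℚ (n ℤ.- ξ n) * third ^ℚ suc r′)
      - third * ω₃partial K (ℤ→ℚ (n ℤ.- ζ n) * third ^ℚ suc r′) ≡ δ₃ n * third ^ℚ suc r′
  combination-exact r′ n K r≤K = begin
    _                                    ≡⟨ sumTo-combination K twoThirds third _ _ _ ⟩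
    sumTo K summand                      ≡⟨ sumTo-single K summand r′ r≤K off-top ⟩
    summand r′                           ≡⟨ summand-defect n s r′ ⟩
    third ^ℚ r′ * defect n (three ^ℚ r′ * s) ≡⟨ cong (third ^ℚ r′ *_) (defect-top n r′) ⟩
    third ^ℚ r′ * (δ₃ n * third)         ≡⟨ solve 3 (λ t d ⅓ → t :* (d :* ⅓) := d :* (⅓ :* t)) refl
                                              (third ^ℚ r′) (δ₃ n) third ⟩
    δ₃ n * third ^ℚ suc r′               ∎
    where
    s = third ^ℚ suc r′
    summand : ℕ → ℚ
    summand k = ω₃term (ℤ→ℚ n * s) k - twoThirds * ω₃term (ℤ→ℚ (n ℤ.- ξ n) * s) k
                                     - third * ω₃term (ℤ→ℚ (n ℤ.- ζ n) * s) k
    off-top : ∀ k → k ≢ r′ → summand k ≡ 0ℚ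
    off-top k k≢r′ = begin
      summand k                                ≡⟨ summand-defect n s k ⟩
      third ^ℚ k * defect n (three ^ℚ k * s)   ≡⟨ cong (third ^ℚ k *_) (defect-off-top n r′ k k≢r′) ⟩
      third ^ℚ k * 0ℚ                          ≡⟨ ℚP.*-zeroʳ (third ^ℚ k) ⟩
      0ℚ                                       ∎

  combination-vanishes : ∀ r′ n K → suc r′ ℕ.≤ K →
    ω₃partial K (ℤ→ℚ n * third ^ℚ suc r′) - twoThirds * ω₃partial K (ℤ→ℚ (n ℤ.- ξ n) * third ^ℚ suc r′)
      - third * ω₃partial K (ℤ→ℚ (n ℤ.- ζ n) * third ^ℚ suc r′) - δ₃ n * third ^ℚ suc r′ ≡ 0ℚ
  combination-vanishes r′ n K r≤K = trans (cong (_- δ₃ n * third ^ℚ suc r′) (combination-exact r′ n K r≤K))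
                                          (ℚP.+-inverseʳ (δ₃ n * third ^ℚ suc r′))

open import Defs
open import Data.Nat using (ℕ; _≥_; _≤_; suc; s≤s)
open import Data.Integer using (ℤ; _-_)
open import Data.Product using (∃; _,_)
open import Data.Rational using (ℚ; _<_; ∣_∣; 0ℚ; _+_; _*_) renaming (_-_ to _-ℚ_)
open import Relation.Binary.PropositionalEquality using (subst; sym)
open ThreePointIdentity using (combination-vanishes)

-- Take N = r: from then on the difference is exactly 0.
corollary3 : (r : ℕ) → r ≥ 1 → (n : ℤ) →
    (ε : ℚ) → 0ℚ < ε → ∃ λ (N : ℕ) → (K : ℕ) → N ≤ K →
      ∣ ((ω₃partial K (ℤ→ℚ n * (third ^ℚ r))
          -ℚ ((third + third) * ω₃partial K (ℤ→ℚ (n - ξ n) * (third ^ℚ r))))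
          -ℚ (third * ω₃partial K (ℤ→ℚ (n - ζ n) * (third ^ℚ r))))
          -ℚ (δ₃ n * (third ^ℚ r)) ∣ < ε
corollary3 (suc r′) (s≤s _) n ε 0<ε =
  suc r′ , λ K r≤K → subst (λ d → ∣ d ∣ < ε) (sym (combination-vanishes r′ n K r≤K)) 0<ε
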